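{- Let $s$ be a non-leaping sequence, $G\in\mathrm{CP}(s)$ the graph of a neighborhood sequence $W_1,\ldots,W_n$ (with associated $a_k$), and $\mathcal{D}$ its distance matrix. For $k\ge 3$ let ${\bf d}=\mathcal{D}({\bf e}_{k-1}-{\bf e}_{a_{k-1}})$. Then for $h\le k$: ${\bf d}_h=1$ if $h<b_{k-1}$; ${\bf d}_h=0$ if $b_{k-1}\le h<k-1$; ${\bf d}_{k-1}=-1$; ${\bf d}_k=0$ if $a_{k-1}=a_k$; and ${\bf d}_k=-1$ if $a_{k-1}<a_k$.
   Context: A sequence of integers $q_1,\ldots,q_n$ ($n\ge 2$) is non-leaping if $q_1=0$, $q_2=1$, and $2\le q_k\le q_{k-1}+1$ for $k=3,\ldots,n$. Set $b_k=k-q_k+1$ for $k\ge 3$, and $a_2=1$, $b_2=2$. A neighborhood sequence is $W_1=\varnothing$, $W_2=\{1\}$, and for $k\ge3$, $W_k=\{a_k\}\cup\{b_k,\ldots,k-1\}$ where $a_k\in W_{k-1}$ and $a_k<b_k$. Its graph has vertex set $\{1,\ldots,n\}$ and edges $\{i,k\}$ for $i\in W_k$; $\mathrm{CP}(s)$ is the set of all such graphs. $\mathcal{D}=[\operatorname{dist}_G(i,j)]$, ${\bf e}_i$ are standard basis vectors, and ${\bf d}_h$ is the $h$-th entry. -}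

module Defs where

open import Data.Nat using (ℕ; zero; suc; _+_; _∸_; _≤_; _<_)
open import Data.Product using (_×_)
open import Data.Sum using (_⊎_)
open import Data.Empty using (⊥)
open import Relation.Binary.PropositionalEquality using (_≡_)

-- All sequences are 1-indexed functions ℕ → ℕ; values outside 1..n are irrelevant.

record NonLeaping (n : ℕ) (q : ℕ → ℕ) : Set where
  field
    n≥2  : 2 ≤ n
    q1   : q 1 ≡ 0
    q2   : q 2 ≡ 1
    qlow : ∀ k → 3 ≤ k → k ≤ n → 2 ≤ q k
    qup  : ∀ k → 3 ≤ k → k ≤ n → q k ≤ q (k ∸ 1) + 1

b : (ℕ → ℕ) → ℕ → ℕ
b q 2 = 2
b q k = (k ∸ q k) + 1

-- i ∈ W_k, where W_1 = ∅ and W_k = {a_k} ∪ {b_k, …, k-1} for k ≥ 2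
-- (for k = 2 this is {a_2} = {1} since b_2 = 2 and a_2 = 1).
InW : (ℕ → ℕ) → (ℕ → ℕ) → ℕ → ℕ → Set
InW q a 0 i = ⊥
InW q a 1 i = ⊥
InW q a k i = (i ≡ a k) ⊎ (b q k ≤ i × i < k)

record NeighborhoodSeq (n : ℕ) (q a : ℕ → ℕ) : Set where
  field
    a2   : a 2 ≡ 1
    aInW : ∀ k → 3 ≤ k → k ≤ n → InW q a (k ∸ 1) (a k)
    a<b  : ∀ k → 3 ≤ k → k ≤ n → a k < b q k

Edge : ℕ → (ℕ → ℕ) → (ℕ → ℕ) → ℕ → ℕ → Set
Edge n q a i k = (1 ≤ k × k ≤ n) × InW q a k i

Adj : ℕ → (ℕ → ℕ) → (ℕ → ℕ) → ℕ → ℕ → Set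
Adj n q a x y = Edge n q a x y ⊎ Edge n q a y x

data Walk (n : ℕ) (q a : ℕ → ℕ) : ℕ → ℕ → ℕ → Set where
  here : ∀ {i} → 1 ≤ i → i ≤ n → Walk n q a i i 0
  step : ∀ {i j k ℓ} → Adj n q a i j → Walk n q a j k ℓ → Walk n q a i k (suc ℓ)

IsDist : ℕ → (ℕ → ℕ) → (ℕ → ℕ) → ℕ → ℕ → ℕ → Set
IsDist n q a i j d = Walk n q a i j d × (∀ m → Walk n q a i j m → d ≤ m)

IsDistMatrix : ℕ → (ℕ → ℕ) → (ℕ → ℕ) → (ℕ → ℕ → ℕ) → Set
IsDistMatrix n q a D =
  ∀ i j → 1 ≤ i → i ≤ n → 1 ≤ j → j ≤ n → IsDist n q a i j (D i j)

module Submission where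

-- W_c is a clique, and a walk from c to a lower vertex can always be rerouted so that its
-- first step goes down into W_c and the rest is strictly shorter. For h < b_c such a first
-- step is either a_c itself or some w ∈ [b_c, c); in the latter case a_c ∈ W_w (membership
-- of a_c in W_{c-1} propagates down the nested intervals), so rerouting once more from w
-- yields a walk from a_c to h that is no longer. Hence d(h,c) = d(h,a_c) + 1; the remaining
-- entries only ask whether two vertices are equal, adjacent, or neither.

open import Defs
open import Data.Nat using (ℕ; zero; suc; _∸_; _≤_; _<_; _+_; z≤n; s≤s)
open import Data.Nat.Properties
open import Data.Nat.Induction using (<-wellFounded)
open import Data.Integer using (+_; _-_; -[1+_]; _⊖_)
open import Data.Integer.Properties using ([+m]-[+n]≡m⊖n; ⊖-≥)
open import Data.Product using (_×_; _,_; proj₁; proj₂; uncurry; ∃; ∃₂)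
open import Data.Sum using (_⊎_; inj₁; inj₂)
open import Data.Empty using (⊥-elim)
open import Induction.WellFounded using (Acc; acc)
open import Relation.Binary.PropositionalEquality
open import Relation.Nullary using (¬_)
open import Relation.Binary using (tri<; tri≈; tri>)

[1+m]⊖m≡1 : ∀ m → suc m ⊖ m ≡ + 1
[1+m]⊖m≡1 m = trans (⊖-≥ (n≤1+n m)) (cong +_ (m+n∸n≡m 1 m))

module NeighborhoodGraph {n : ℕ} {q a : ℕ → ℕ} (nl : NonLeaping n q) (ns : NeighborhoodSeq n q a) where
  open NonLeaping nl
  open NeighborhoodSeq ns

  _∈W_ : ℕ → ℕ → Set
  i ∈W k = InW q a k i

  _~_ : ℕ → ℕ → Set
  x ~ y = Adj n q a x y

  Vertex : ℕ → Set
  Vertex i = 1 ≤ i × i ≤ n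

  b≡ : ∀ {k} → 2 ≤ k → b q k ≡ k ∸ q k + 1
  b≡ {suc zero} (s≤s ())
  b≡ {suc (suc zero)} _ rewrite q2 = refl
  b≡ {suc (suc (suc k))} _ = refl

  b-pred≤b : ∀ {k} → 3 ≤ k → k ≤ n → b q (k ∸ 1) ≤ b q k
  b-pred≤b {suc k} (s≤s 2≤k) k≤n rewrite b≡ 2≤k | b≡ (≤-trans 2≤k (n≤1+n k)) =
    +-monoˡ-≤ 1 (subst (_≤ suc k ∸ q (suc k)) (cong (suc k ∸_) (+-comm (q k) 1))
                       (∸-monoʳ-≤ (suc k) (qup (suc k) (s≤s 2≤k) k≤n)))

  b-mono : ∀ {j k} → 2 ≤ j → j ≤ k → k ≤ n → b q j ≤ b q k
  b-mono {k = zero} (s≤s _) () _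
  b-mono {j} {suc k} 2≤j j≤k k≤n with m≤n⇒m<n∨m≡n j≤k
  ... | inj₂ refl = ≤-refl
  ... | inj₁ (s≤s j≤k′) = ≤-trans (b-mono 2≤j j≤k′ (≤-trans (n≤1+n k) k≤n))
                                  (b-pred≤b (s≤s (≤-trans 2≤j j≤k′)) k≤n)

  2≤b : ∀ {k} → 2 ≤ k → k ≤ n → 2 ≤ b q k
  2≤b 2≤k k≤n = b-mono ≤-refl 2≤k k≤n

  b<k : ∀ {k} → 3 ≤ k → k ≤ n → b q k < k
  b<k {k@(suc (suc (suc m)))} 3≤k@(s≤s (s≤s (s≤s _))) k≤n =
    s≤s (subst (k ∸ q k + 1 ≤_) (+-comm (suc m) 1)
               (+-monoˡ-≤ 1 (∸-monoʳ-≤ k (qlow k 3≤k k≤n))))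

  b≤k : ∀ {k} → 2 ≤ k → k ≤ n → b q k ≤ k
  b≤k 2≤k k≤n with m≤n⇒m<n∨m≡n 2≤k
  ... | inj₂ refl = ≤-refl
  ... | inj₁ 3≤k = <⇒≤ (b<k 3≤k k≤n)

  a<b′ : ∀ {k} → 2 ≤ k → k ≤ n → a k < b q k
  a<b′ 2≤k k≤n with m≤n⇒m<n∨m≡n 2≤k
  ... | inj₂ refl rewrite a2 = ≤-refl
  ... | inj₁ 3≤k = a<b _ 3≤k k≤n

  ∈W⇒2≤k : ∀ {i k} → i ∈W k → 2 ≤ k
  ∈W⇒2≤k {k = suc (suc _)} _ = s≤s (s≤s z≤n)

  ∈W-cases : ∀ {i k} → 2 ≤ k → i ∈W k → i ≡ a k ⊎ (b q k ≤ i × i < k)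
  ∈W-cases {k = suc (suc _)} _ i∈W = i∈W

  a∈W-self : ∀ {k} → 2 ≤ k → a k ∈W k
  a∈W-self {suc (suc _)} (s≤s (s≤s _)) = inj₁ refl

  ∈W-interval : ∀ {i k} → b q k ≤ i → i < k → i ∈W k
  ∈W-interval {k = zero} _ ()
  ∈W-interval {k = suc zero} b≤i (s≤s i≤0) = ⊥-elim (n≮0 (≤-trans (m≤n+m 1 (1 ∸ q 1)) (≤-trans b≤i i≤0)))
  ∈W-interval {k = suc (suc _)} b≤i i<k = inj₂ (b≤i , i<k)

  1≤a : ∀ {k} → 2 ≤ k → k ≤ n → 1 ≤ a k
  1≤a {suc k} (s≤s 1≤k) k≤n with m≤n⇒m<n∨m≡n 1≤k
  ... | inj₂ refl = ≤-reflexive (sym a2)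
  ... | inj₁ 2≤k with ∈W-cases 2≤k (aInW (suc k) (s≤s 2≤k) k≤n)
  ...   | inj₁ eq = subst (1 ≤_) (sym eq) (1≤a 2≤k (≤-trans (n≤1+n k) k≤n))
  ...   | inj₂ (b≤a , _) = ≤-trans (s≤s z≤n) (≤-trans (2≤b 2≤k (≤-trans (n≤1+n k) k≤n)) b≤a)

  ∈W⇒bounds : ∀ {i k} → k ≤ n → i ∈W k → 1 ≤ i × i < k
  ∈W⇒bounds k≤n i∈W with ∈W⇒2≤k i∈W
  ... | 2≤k with ∈W-cases 2≤k i∈W
  ...   | inj₁ refl = 1≤a 2≤k k≤n , <-≤-trans (a<b′ 2≤k k≤n) (b≤k 2≤k k≤n)
  ...   | inj₂ (b≤i , i<k) = ≤-trans (s≤s z≤n) (≤-trans (2≤b 2≤k k≤n) b≤i) , i<k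

  -- a_c ∈ W_{c-1}: either a_c = a_{c-1} and we recurse on c-1, or a_c ∈ [b_{c-1}, c-1),
  -- which lies inside [b_h, h) because b is monotone.
  a∈W : ∀ {c h} → 3 ≤ c → c ≤ n → b q c ≤ h → h < c → a c ∈W h
  a∈W {suc c} {h} 3≤c c≤n b≤h (s≤s h≤c) with m≤n⇒m<n∨m≡n h≤c
  ... | inj₂ refl = aInW (suc c) 3≤c c≤n
  ... | inj₁ h<c with ∈W-cases (≤-pred 3≤c) (aInW (suc c) 3≤c c≤n)
  ...   | inj₂ (b≤a , _) =
          ∈W-interval (≤-trans (b-mono 2≤h (<⇒≤ h<c) (≤-trans (n≤1+n c) c≤n)) b≤a)
                      (<-≤-trans (a<b (suc c) 3≤c c≤n) b≤h)
    where 2≤h = ≤-trans (2≤b (<⇒≤ 3≤c) c≤n) b≤h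
  ...   | inj₁ eq rewrite eq =
          a∈W (≤-trans (s≤s (≤-trans (2≤b (<⇒≤ 3≤c) c≤n) b≤h)) h<c)
              (≤-trans (n≤1+n c) c≤n) (≤-trans (b-pred≤b 3≤c c≤n) b≤h) h<c

  edge⇒~ : ∀ {i k} → 1 ≤ k → k ≤ n → i ∈W k → i ~ k
  edge⇒~ 1≤k k≤n i∈W = inj₁ ((1≤k , k≤n) , i∈W)

  ~-sym : ∀ {x y} → x ~ y → y ~ x
  ~-sym (inj₁ e) = inj₂ e
  ~-sym (inj₂ e) = inj₁ e

  ∈W⇒vertex : ∀ {i k} → k ≤ n → i ∈W k → Vertex i
  ∈W⇒vertex k≤n i∈W with ∈W⇒bounds k≤n i∈W
  ... | 1≤i , i<k = 1≤i , <⇒≤ (<-≤-trans i<k k≤n)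

  ~⇒vertices : ∀ {x y} → x ~ y → Vertex x × Vertex y
  ~⇒vertices (inj₁ (y , x∈W)) = ∈W⇒vertex (proj₂ y) x∈W , y
  ~⇒vertices (inj₂ (x , y∈W)) = x , ∈W⇒vertex (proj₂ x) y∈W

  a~interval : ∀ {v y} → 2 ≤ v → v ≤ n → b q v ≤ y → y < v → a v ~ y
  a~interval 2≤v v≤n b≤y y<v = edge⇒~ (≤-trans (s≤s z≤n) 2≤y) (<⇒≤ (<-≤-trans y<v v≤n))
                                      (a∈W (≤-trans (s≤s 2≤y) y<v) v≤n b≤y y<v)
    where 2≤y = ≤-trans (2≤b 2≤v v≤n) b≤y

  interval~interval : ∀ {v x y} → 2 ≤ v → v ≤ n → b q v ≤ x → x < y → y < v → x ~ y
  interval~interval 2≤v v≤n b≤x x<y y<v =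
    edge⇒~ (≤-trans (s≤s z≤n) 2≤y) y≤n
           (∈W-interval (≤-trans (b-mono 2≤y (<⇒≤ y<v) v≤n) b≤x) x<y)
    where 2≤y = ≤-trans (2≤b 2≤v v≤n) (≤-trans b≤x (<⇒≤ x<y))
          y≤n = <⇒≤ (<-≤-trans y<v v≤n)

  W-clique : ∀ {v x y} → v ≤ n → x ∈W v → y ∈W v → x ≡ y ⊎ x ~ y
  W-clique {v} {x} {y} v≤n x∈W y∈W with ∈W⇒2≤k x∈W
  ... | 2≤v with ∈W-cases 2≤v x∈W | ∈W-cases 2≤v y∈W
  ...   | inj₁ refl | inj₁ refl = inj₁ refl
  ...   | inj₁ refl | inj₂ (b≤y , y<v) = inj₂ (a~interval 2≤v v≤n b≤y y<v)
  ...   | inj₂ (b≤x , x<v) | inj₁ refl = inj₂ (~-sym (a~interval 2≤v v≤n b≤x x<v))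
  ...   | inj₂ (b≤x , x<v) | inj₂ (b≤y , y<v) with <-cmp x y
  ...     | tri< x<y _ _ = inj₂ (interval~interval 2≤v v≤n b≤x x<y y<v)
  ...     | tri≈ _ x≡y _ = inj₁ x≡y
  ...     | tri> _ _ y<x = inj₂ (~-sym (interval~interval 2≤v v≤n b≤y y<x x<v))

  Walk′ : ℕ → ℕ → ℕ → Set
  Walk′ = Walk n q a

  walk⇒vertices : ∀ {i j ℓ} → Walk′ i j ℓ → Vertex i × Vertex j
  walk⇒vertices (here 1≤i i≤n) = (1≤i , i≤n) , (1≤i , i≤n)
  walk⇒vertices (step x~y w) = proj₁ (~⇒vertices x~y) , proj₂ (walk⇒vertices w)

  _▷_ : ∀ {i j k ℓ} → Walk′ i j ℓ → j ~ k → Walk′ i k (suc ℓ)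
  here _ _ ▷ j~k = step j~k (uncurry here (proj₂ (~⇒vertices j~k)))
  step x~y w ▷ j~k = step x~y (w ▷ j~k)

  reverse : ∀ {i j ℓ} → Walk′ i j ℓ → Walk′ j i ℓ
  reverse (here 1≤i i≤n) = here 1≤i i≤n
  reverse (step x~y w) = reverse w ▷ ~-sym x~y

  LowerExit : ℕ → ℕ → ℕ → Set
  LowerExit v u ℓ = ∃₂ λ w m → w ∈W v × m < ℓ × Walk′ w u m

  LowerExit-weaken : ∀ {v u m ℓ} → m ≤ ℓ → LowerExit v u m → LowerExit v u ℓ
  LowerExit-weaken m≤ℓ (w , m′ , w∈W , m′<m , walk) = w , m′ , w∈W , <-≤-trans m′<m m≤ℓ , walk

  -- A walk that first climbs to y > v can be rerouted: W_y is a clique containing v,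
  -- so v reaches the next vertex of the walk in W_y directly, and the walk gets shorter.
  lower-exit : ∀ {v u ℓ} → u < v → Walk′ v u ℓ → LowerExit v u ℓ
  lower-exit u<v walk = go (<-wellFounded _) u<v walk
    where
    go : ∀ {v u ℓ} → Acc _<_ ℓ → u < v → Walk′ v u ℓ → LowerExit v u ℓ
    go _ u<v (here _ _) = ⊥-elim (<-irrefl refl u<v)
    go _ _ (step (inj₂ (_ , y∈W)) walk) = _ , _ , y∈W , ≤-refl , walk
    go (acc rec) u<v (step (inj₁ ((_ , y≤n) , v∈W)) walk)
      with go (rec ≤-refl) (<-trans u<v (proj₂ (∈W⇒bounds y≤n v∈W))) walk
    ... | w , m , w∈W , m<ℓ , w→u with W-clique y≤n v∈W w∈W
    ...   | inj₁ refl = LowerExit-weaken (m≤n⇒m≤1+n (<⇒≤ m<ℓ)) (go (rec (m≤n⇒m≤1+n m<ℓ)) u<v w→u)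
    ...   | inj₂ v~w = LowerExit-weaken (m≤n⇒m≤1+n m<ℓ) (go (rec (s≤s m<ℓ)) u<v (step v~w w→u))

  walk-via-a : ∀ {c h ℓ} → 2 ≤ c → c ≤ n → h < b q c → Walk′ c h ℓ →
               ∃ λ m → m < ℓ × Walk′ (a c) h m
  walk-via-a 2≤c c≤n h<b walk with lower-exit (<-≤-trans h<b (b≤k 2≤c c≤n)) walk
  ... | w , m , w∈W , m<ℓ , w→h with ∈W-cases 2≤c w∈W
  ...   | inj₁ refl = m , m<ℓ , w→h
  ...   | inj₂ (b≤w , w<c) with lower-exit (<-≤-trans h<b b≤w) w→h
  ...     | w′ , m′ , w′∈W , m′<m , w′→h
            with W-clique (<⇒≤ (<-≤-trans w<c c≤n)) (a∈W 3≤c c≤n b≤w w<c) w′∈W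
    where 3≤c = ≤-trans (s≤s (≤-trans (2≤b 2≤c c≤n) b≤w)) w<c
  ...       | inj₁ refl = m′ , <-trans m′<m m<ℓ , w′→h
  ...       | inj₂ a~w′ = suc m′ , ≤-<-trans m′<m m<ℓ , step a~w′ w′→h

  module Distances (D : ℕ → ℕ → ℕ) (isD : IsDistMatrix n q a D) where

    isDist : ∀ {i j ℓ} → Walk′ i j ℓ → IsDist n q a i j (D i j)
    isDist walk with walk⇒vertices walk
    ... | (1≤i , i≤n) , (1≤j , j≤n) = isD _ _ 1≤i i≤n 1≤j j≤n

    shortest : ∀ {i j} → Vertex i → Vertex j → Walk′ i j (D i j)
    shortest (1≤i , i≤n) (1≤j , j≤n) = proj₁ (isD _ _ 1≤i i≤n 1≤j j≤n)

    dist≤ : ∀ {i j ℓ} → Walk′ i j ℓ → D i j ≤ ℓ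
    dist≤ walk = proj₂ (isDist walk) _ walk

    dist≡ : ∀ {i j d} → Walk′ i j d → (∀ {ℓ} → Walk′ i j ℓ → d ≤ ℓ) → D i j ≡ d
    dist≡ walk lower = ≤-antisym (dist≤ walk) (lower (proj₁ (isDist walk)))

    dist-self : ∀ {i} → 1 ≤ i → i ≤ n → D i i ≡ 0
    dist-self 1≤i i≤n = n≤0⇒n≡0 (dist≤ (here 1≤i i≤n))

    dist-~ : ∀ {i j} → i ≢ j → i ~ j → D i j ≡ 1
    dist-~ i≢j i~j = dist≡ (step i~j (uncurry here (proj₂ (~⇒vertices i~j)))) nonempty
      where
      nonempty : ∀ {ℓ} → Walk′ _ _ ℓ → 1 ≤ ℓ
      nonempty (here _ _) = ⊥-elim (i≢j refl)
      nonempty (step _ _) = s≤s z≤n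

    dist-non-adjacent : ∀ {i j d} → i ≢ j → ¬ i ~ j → Walk′ i j d → d ≤ 2 → D i j ≡ 2
    dist-non-adjacent i≢j i≁j walk d≤2 = ≤-antisym (≤-trans (dist≤ walk) d≤2) (long (proj₁ (isDist walk)))
      where
      long : ∀ {ℓ} → Walk′ _ _ ℓ → 2 ≤ ℓ
      long (here _ _) = ⊥-elim (i≢j refl)
      long (step i~j (here _ _)) = ⊥-elim (i≁j i~j)
      long (step _ (step _ _)) = s≤s (s≤s z≤n)

    module AtVertex {c : ℕ} (2≤c : 2 ≤ c) (c≤n : c ≤ n) where

      c-vertex : Vertex c
      c-vertex = ≤-trans (s≤s z≤n) 2≤c , c≤n

      a~c : a c ~ c
      a~c = uncurry edge⇒~ c-vertex (a∈W-self 2≤c)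

      a-vertex : Vertex (a c)
      a-vertex = proj₁ (~⇒vertices a~c)

      a<c : a c < c
      a<c = <-≤-trans (a<b′ 2≤c c≤n) (b≤k 2≤c c≤n)

      dist-to-a : D c (a c) ≡ 1
      dist-to-a = dist-~ (λ c≡a → <-irrefl (sym c≡a) a<c) (~-sym a~c)

      dist-below-b : ∀ {h} → 1 ≤ h → h < b q c → D h c ≡ suc (D h (a c))
      dist-below-b {h} 1≤h h<b = ≤-antisym (dist≤ (shortest h-vertex a-vertex ▷ a~c)) through-a
        where
        h-vertex = 1≤h , <⇒≤ (<-≤-trans (<-≤-trans h<b (b≤k 2≤c c≤n)) c≤n)
        through-a : D h (a c) < D h c
        through-a with walk-via-a 2≤c c≤n h<b (reverse (shortest h-vertex c-vertex))
        ... | m , m<d , a→h = ≤-<-trans (dist≤ (reverse a→h)) m<d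

      dist-interval : ∀ {h} → b q c ≤ h → h < c → D h c ≡ 1 × D h (a c) ≡ 1
      dist-interval b≤h h<c =
        dist-~ (λ h≡c → <-irrefl h≡c h<c) (uncurry edge⇒~ c-vertex (∈W-interval b≤h h<c)) ,
        dist-~ (λ h≡a → <-irrefl (sym h≡a) (<-≤-trans (a<b′ 2≤c c≤n) b≤h)) (~-sym (a~interval 2≤c c≤n b≤h h<c))

      module AtSuccessor (1+c≤n : suc c ≤ n) where

        c~1+c : c ~ suc c
        c~1+c = edge⇒~ (s≤s z≤n) 1+c≤n (∈W-interval (≤-pred (b<k (s≤s 2≤c) 1+c≤n)) ≤-refl)

        1+c≢a : suc c ≢ a c
        1+c≢a 1+c≡a = <-irrefl (sym 1+c≡a) (<-trans a<c (n<1+n c))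

        dist-succ : D (suc c) c ≡ 1
        dist-succ = dist-~ (λ 1+c≡c → <-irrefl (sym 1+c≡c) (n<1+n c)) (~-sym c~1+c)

        dist-succ-to-a-≡ : a c ≡ a (suc c) → D (suc c) (a c) ≡ 1
        dist-succ-to-a-≡ a≡a′ =
          dist-~ 1+c≢a (~-sym (edge⇒~ (s≤s z≤n) 1+c≤n (subst (_∈W suc c) (sym a≡a′) (a∈W-self (m≤n⇒m≤1+n 2≤c)))))

        -- a_c ∉ W_{c+1}: it is not a_{c+1}, and it lies below b_c ≤ b_{c+1}.
        dist-succ-to-a-< : a c < a (suc c) → D (suc c) (a c) ≡ 2
        dist-succ-to-a-< a<a′ =
          dist-non-adjacent 1+c≢a 1+c≁a (step (~-sym c~1+c) (step (~-sym a~c) (uncurry here a-vertex))) ≤-refl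
          where
          1+c≁a : ¬ suc c ~ a c
          1+c≁a (inj₁ (_ , 1+c∈W)) = <-asym (<-trans a<c (n<1+n c)) (proj₂ (∈W⇒bounds (proj₂ a-vertex) 1+c∈W))
          1+c≁a (inj₂ (_ , a∈W′)) with ∈W-cases (m≤n⇒m≤1+n 2≤c) a∈W′
          ... | inj₁ a≡a′ = <-irrefl a≡a′ a<a′
          ... | inj₂ (b≤a , _) = <-irrefl refl (<-≤-trans (a<b′ 2≤c c≤n) (≤-trans (b-pred≤b (s≤s 2≤c) 1+c≤n) b≤a))

corollary2p11 : ∀ (n : ℕ) (q a : ℕ → ℕ) → NonLeaping n q → NeighborhoodSeq n q a →
    (D : ℕ → ℕ → ℕ) → IsDistMatrix n q a D →
    ∀ (k : ℕ) → 3 ≤ k → k ≤ n →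
    (∀ h → 1 ≤ h → h < b q (k ∸ 1) → (+ D h (k ∸ 1)) - (+ D h (a (k ∸ 1))) ≡ + 1)
    × (∀ h → b q (k ∸ 1) ≤ h → h < k ∸ 1 → (+ D h (k ∸ 1)) - (+ D h (a (k ∸ 1))) ≡ + 0)
    × ((+ D (k ∸ 1) (k ∸ 1)) - (+ D (k ∸ 1) (a (k ∸ 1))) ≡ -[1+ 0 ])
    × (a (k ∸ 1) ≡ a k → (+ D k (k ∸ 1)) - (+ D k (a (k ∸ 1))) ≡ + 0)
    × (a (k ∸ 1) < a k → (+ D k (k ∸ 1)) - (+ D k (a (k ∸ 1))) ≡ -[1+ 0 ])
corollary2p11 n q a nl ns D isD (suc c) (s≤s 2≤c) 1+c≤n =
    (λ h 1≤h h<b → trans (difference {y = D h (a c)} (dist-below-b 1≤h h<b) refl)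
                         ([1+m]⊖m≡1 (D h (a c))))
  , (λ h b≤h h<c → difference (proj₁ (dist-interval b≤h h<c)) (proj₂ (dist-interval b≤h h<c)))
  , difference (uncurry dist-self c-vertex) dist-to-a
  , (λ a≡a′ → difference dist-succ (dist-succ-to-a-≡ a≡a′))
  , (λ a<a′ → difference dist-succ (dist-succ-to-a-< a<a′))
  where
  open NeighborhoodGraph nl ns
  open Distances D isD
  c≤n = ≤-trans (n≤1+n c) 1+c≤n
  open AtVertex 2≤c c≤n
  open AtSuccessor 1+c≤n
  difference : ∀ {x y u v} → x ≡ u → y ≡ v → + x - + y ≡ u ⊖ v
  difference {x} {y} refl refl = [+m]-[+n]≡m⊖n x y
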